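{- A positive integer $x>1$ is a $\tau_5$-atom if and only if one of the following holds: (i) $x$ is prime; (ii) $x=5p_1p_2\cdots p_k$ with $k\ge 0$ and each $p_i$ a prime different from $5$; (iii) in the prime factorization of $x$ (primes counted with multiplicity), every prime factor is congruent to $\pm1 \pmod 5$ except for exactly one prime factor, which is congruent to $\pm 2\pmod 5$.
   Context: For a positive integer $n$ and integers $x,y$, write $x\,\tau_n\,y$ if $x\equiv y \pmod n$. For a nonzero nonunit integer $x$, a $\tau_n$-factorization of $x$ is an expression $x=\lambda a_1a_2\cdots a_k$ with $\lambda\in\{1,-1\}$, each $a_i$ a nonzero nonunit integer (i.e. $a_i\neq 0,\pm1$), and $a_i\equiv a_j \pmod n$ for all $i,j$; it is proper if $k>1$. A nonzero nonunit integer $x$ is a $\tau_n$-atom if it has no proper $\tau_n$-factorization. "Prime" means a positive prime number. -}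

module Defs where

open import Data.Nat using (ℕ; _%_)
open import Data.Nat.Primality using (Prime)
open import Data.Integer using (ℤ; +_; -_; _*_; _-_; ∣_∣)
open import Data.Integer.Divisibility using (_∣_)
open import Data.List using (List; []; _∷_; foldr; length)
open import Data.List.Relation.Unary.All using (All)
open import Data.List.Membership.Propositional using (_∈_)
open import Data.Product using (Σ; _×_; ∃)
open import Data.Sum using (_⊎_)
open import Relation.Nullary using (¬_)
open import Relation.Binary.PropositionalEquality using (_≡_; _≢_)
import Data.Nat as ℕ

_τ[_]_ : ℤ → ℕ → ℤ → Set
x τ[ n ] y = (+ n) ∣ (x - y)

prodℤ : List ℤ → ℤ
prodℤ = foldr _*_ (+ 1)

NonzeroNonunit : ℤ → Set
NonzeroNonunit a = (a ≢ + 0) × (∣ a ∣ ≢ 1)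

record τFactorization (n : ℕ) (x : ℤ) : Set where
  field
    unit      : ℤ
    unit-pm1  : (unit ≡ + 1) ⊎ (unit ≡ - (+ 1))
    factors   : List ℤ
    nzNonunit : All NonzeroNonunit factors
    congr     : ∀ {a b} → a ∈ factors → b ∈ factors → a τ[ n ] b
    eqn       : x ≡ unit * prodℤ factors

Proper : ∀ {n x} → τFactorization n x → Set
Proper f = 1 ℕ.< length (τFactorization.factors f)

τAtom : ℕ → ℤ → Set
τAtom n x = NonzeroNonunit x × ¬ (Σ (τFactorization n x) Proper)

≡±1mod5 : ℕ → Set
≡±1mod5 p = (p % 5 ≡ 1) ⊎ (p % 5 ≡ 4)

≡±2mod5 : ℕ → Set
≡±2mod5 p = (p % 5 ≡ 2) ⊎ (p % 5 ≡ 3)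

prodℕ : List ℕ → ℕ
prodℕ = foldr ℕ._*_ 1

FormII : ℕ → Set
FormII x = ∃ λ (ps : List ℕ) → All (λ p → Prime p × p ≢ 5) ps × x ≡ 5 ℕ.* prodℕ ps

FormIII : ℕ → Set
FormIII x = ∃ λ (q : ℕ) → ∃ λ (ps : List ℕ) →
  Prime q × ≡±2mod5 q × All (λ p → Prime p × ≡±1mod5 p) ps × x ≡ q ℕ.* prodℕ ps

module Submission where

open import Defs
open import Data.Nat using (ℕ; _<_)
open import Data.Nat.Primality using (Prime)
open import Data.Integer using (+_)
open import Data.Sum using (_⊎_)
open import Function.Bundles using (_⇔_)
open import Function.Properties.Equivalence using () renaming (trans to ⇔-trans)

-- A τ₅-factorisation can be understood through square residues modulo 5.  If a ≡ b (mod p)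
-- then a² ≡ b² (mod p), and for a prime p the converse holds up to sign.  Hence, forgetting
-- signs, a proper τ_p-factorisation of x > 1 is the same as a square splitting of x: a
-- product x = n₁ ⋯ n_k with k ≥ 2, every nᵢ ≥ 2, and all nᵢ² congruent modulo p.
--
-- Classification primes and forms (ii), (iii) have no splitting modulo 5 (the residues of the
--                factors are forced to clash), while every other x > 1 has one, found by
--                counting the prime factors of x that are ≡ ±2 (mod 5).
-- theorem9 chains the two equivalences of Bridge and Classification.

module Congruence where

  open import Data.Nat as ℕ using (ℕ; _≤_; NonZero)
  open import Data.Nat.Properties using (≤-total; m+[n∸m]≡n; [m+n]∸[m+o]≡n∸o; *-distribʳ-∸)
  open import Data.Nat.DivMod using (_%_; _/_; [m+kn]%n≡m%n; m≡m%n+[m/n]*n)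
  open import Data.Nat.Divisibility using (divides)
  import Data.Nat.Divisibility as ℕ
  open import Data.Nat.Primality using (Prime; euclidsLemma)
  open import Data.Integer using (+_; -[1+_]; _+_; _-_; _*_; ∣_∣; _◃_)
  open import Data.Integer.Properties using ([+m]-[+n]≡m⊖n; ⊖-≥; ∣i-j∣≡∣j-i∣; ∣-i∣≡∣i∣; abs-*; pos-*; +◃n≡+n; -◃n≡-n; neg-distrib-+)
  open import Data.Integer.Divisibility.Signed using (∣ᵤ⇒∣; ∣⇒∣ᵤ; ∣m∣n⇒∣m+n; ∣n⇒∣m*n; ∣m⇒∣m*n)
  import Data.Integer.Divisibility.Signed as Signed
  open import Data.Integer.Tactic.RingSolver using (solve-∀)
  open import Data.Sign using (Sign)
  open import Data.Product using (Σ; _,_)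
  open import Data.Sum using (_⊎_; inj₁; inj₂)
  open import Function.Bundles using (_⇔_; mk⇔; Equivalence)
  open import Relation.Binary.PropositionalEquality
  open ≡-Reasoning

  τ-sym : ∀ {n} x y → x τ[ n ] y → y τ[ n ] x
  τ-sym {n} x y = subst (n ℕ.∣_) (∣i-j∣≡∣j-i∣ x y)

  τ-trans : ∀ {n} x y z → x τ[ n ] y → y τ[ n ] z → x τ[ n ] z
  τ-trans {n} x y z x≡y y≡z =
    ∣⇒∣ᵤ (subst (+ n Signed.∣_) (telescope x y z) (∣m∣n⇒∣m+n (∣ᵤ⇒∣ {i = x - y} x≡y) (∣ᵤ⇒∣ {i = y - z} y≡z)))
    where
    telescope : ∀ x y z → (x - y) + (y - z) ≡ x - z
    telescope = solve-∀

  τ-* : ∀ {n x x′ y y′} → x τ[ n ] x′ → y τ[ n ] y′ → (x * y) τ[ n ] (x′ * y′)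
  τ-* {n} {x} {x′} {y} {y′} x≡x′ y≡y′ =
    ∣⇒∣ᵤ (subst (+ n Signed.∣_) (split x x′ y y′)
      (∣m∣n⇒∣m+n (∣m⇒∣m*n y (∣ᵤ⇒∣ {i = x - x′} x≡x′)) (∣n⇒∣m*n x′ (∣ᵤ⇒∣ {i = y - y′} y≡y′))))
    where
    split : ∀ x x′ y y′ → (x - x′) * y + x′ * (y - y′) ≡ x * y - x′ * y′
    split = solve-∀

  ∣∸⇔%≡ : ∀ m {a b} .{{_ : NonZero m}} → b ≤ a → m ℕ.∣ (a ℕ.∸ b) ⇔ (a % m ≡ b % m)
  ∣∸⇔%≡ m {a} {b} b≤a = mk⇔ to from
    where
    to : m ℕ.∣ (a ℕ.∸ b) → a % m ≡ b % m
    to (divides k a∸b≡km) = begin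
      a % m                   ≡⟨ cong (_% m) (m+[n∸m]≡n b≤a) ⟨
      (b ℕ.+ (a ℕ.∸ b)) % m   ≡⟨ cong (λ d → (b ℕ.+ d) % m) a∸b≡km ⟩
      (b ℕ.+ k ℕ.* m) % m     ≡⟨ [m+kn]%n≡m%n b k m ⟩
      b % m                   ∎
    from : a % m ≡ b % m → m ℕ.∣ (a ℕ.∸ b)
    from same = divides (a / m ℕ.∸ b / m) (begin
      a ℕ.∸ b                                                ≡⟨ cong₂ ℕ._∸_ (m≡m%n+[m/n]*n a m) (m≡m%n+[m/n]*n b m) ⟩
      (a % m ℕ.+ a / m ℕ.* m) ℕ.∸ (b % m ℕ.+ b / m ℕ.* m)    ≡⟨ cong (λ r → (r ℕ.+ a / m ℕ.* m) ℕ.∸ (b % m ℕ.+ b / m ℕ.* m)) same ⟩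
      (b % m ℕ.+ a / m ℕ.* m) ℕ.∸ (b % m ℕ.+ b / m ℕ.* m)    ≡⟨ [m+n]∸[m+o]≡n∸o (b % m) _ _ ⟩
      a / m ℕ.* m ℕ.∸ b / m ℕ.* m                            ≡⟨ *-distribʳ-∸ m (a / m) (b / m) ⟨
      (a / m ℕ.∸ b / m) ℕ.* m                                ∎)

  τ⇔%≡-ordered : ∀ m {a b} .{{_ : NonZero m}} → b ≤ a → (+ a) τ[ m ] (+ b) ⇔ (a % m ≡ b % m)
  τ⇔%≡-ordered m {a} {b} b≤a = subst (λ d → m ℕ.∣ d ⇔ (a % m ≡ b % m)) (sym ∣a-b∣≡a∸b) (∣∸⇔%≡ m b≤a)
    where
    ∣a-b∣≡a∸b : ∣ + a - + b ∣ ≡ a ℕ.∸ b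
    ∣a-b∣≡a∸b = cong ∣_∣ (trans ([+m]-[+n]≡m⊖n a b) (⊖-≥ b≤a))

  τ⇔%≡ : ∀ m a b .{{_ : NonZero m}} → (+ a) τ[ m ] (+ b) ⇔ (a % m ≡ b % m)
  τ⇔%≡ m a b with ≤-total b a
  ... | inj₁ b≤a = τ⇔%≡-ordered m b≤a
  ... | inj₂ a≤b = mk⇔ (λ a≡b → sym (Equivalence.to swapped (τ-sym (+ a) (+ b) a≡b)))
                       (λ same → τ-sym (+ b) (+ a) (Equivalence.from swapped (sym same)))
    where swapped = τ⇔%≡-ordered m a≤b

  sqRes : (m : ℕ) .{{_ : NonZero m}} → ℕ → ℕ
  sqRes m n = (n ℕ.* n) % m

  τ⇒sqRes≡ : ∀ {m} x y .{{_ : NonZero m}} → x τ[ m ] y → sqRes m ∣ x ∣ ≡ sqRes m ∣ y ∣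
  τ⇒sqRes≡ {m} x y x≡y =
    Equivalence.to (τ⇔%≡ m _ _) (subst₂ (_τ[ m ]_) (square x) (square y) (τ-* {m} {x} {y} x≡y x≡y))
    where
    square : ∀ z → z * z ≡ + (∣ z ∣ ℕ.* ∣ z ∣)
    square (+ n)     = sym (pos-* n n)
    square -[1+ n ]  = refl

  -- modulo a prime p, equal square residues mean congruence up to sign, since
  -- p ∣ a² - b² = (a - b)(a + b) forces p ∣ a - b or p ∣ a + b
  sqRes≡⇒τ± : ∀ {p} a b .{{_ : NonZero p}} → Prime p → sqRes p a ≡ sqRes p b →
              Σ Sign λ s → (s ◃ a) τ[ p ] (+ b)
  sqRes≡⇒τ± {p} a b p-prime same = choose (euclidsLemma _ _ p-prime p∣product)
    where
    factor : ∀ x y → x * x - y * y ≡ (x - y) * (x + y)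
    factor = solve-∀
    difference : + (a ℕ.* a) - + (b ℕ.* b) ≡ (+ a - + b) * (+ a + + b)
    difference = trans (cong₂ _-_ (pos-* a a) (pos-* b b)) (factor (+ a) (+ b))
    p∣product : p ℕ.∣ ∣ + a - + b ∣ ℕ.* ∣ + a + + b ∣
    p∣product = subst (p ℕ.∣_) (trans (cong ∣_∣ difference) (abs-* (+ a - + b) (+ a + + b)))
                      (Equivalence.from (τ⇔%≡ p (a ℕ.* a) (b ℕ.* b)) same)
    choose : p ℕ.∣ ∣ + a - + b ∣ ⊎ p ℕ.∣ ∣ + a + + b ∣ → Σ Sign λ s → (s ◃ a) τ[ p ] (+ b)
    choose (inj₁ p∣a-b) = Sign.+ , subst (_τ[ p ] (+ b)) (sym (+◃n≡+n a)) p∣a-b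
    choose (inj₂ p∣a+b) = Sign.- , subst (_τ[ p ] (+ b)) (sym (-◃n≡-n a))
      (subst (p ℕ.∣_) (trans (sym (∣-i∣≡∣i∣ (+ a + + b))) (cong ∣_∣ (neg-distrib-+ (+ a) (+ b)))) p∣a+b)

module Bridge where

  open import Data.Nat as ℕ using (ℕ; suc; _≤_; _<_; z≤n; s≤s; NonZero)
  open import Data.Nat.Properties using (*-identityˡ)
  open import Data.Nat.Primality using (Prime)
  open import Data.Integer using (ℤ; +_; -_; _*_; ∣_∣; _◃_)
  open import Data.Integer.Properties using (∣i∣≡0⇒i≡0; abs-◃; abs-*; +◃n≡+n; ◃-distrib-*)
  open import Data.Sign as Sign using (Sign)
  open import Data.Sign.Properties using (s*s≡+)
  open import Data.List using (List; []; _∷_; length; map)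
  open import Data.List.Properties using (length-map)
  open import Data.List.Relation.Unary.All as All using (All; []; _∷_)
  open import Data.List.Relation.Unary.All.Properties using (map⁺)
  open import Data.List.Relation.Unary.Any using (here)
  open import Data.Product using (Σ; _×_; _,_; proj₁; proj₂)
  open import Data.Sum using (_⊎_; inj₁; inj₂)
  open import Function.Bundles using (_⇔_; mk⇔; Equivalence)
  open import Data.Empty using (⊥-elim)
  open import Relation.Nullary using (¬_)
  open import Relation.Binary.PropositionalEquality
  open ≡-Reasoning
  open Congruence

  -- a splitting of x into at least two factors ≥ 2 sharing one square residue modulo m;
  -- this is the shape of a proper τ_m-factorisation once signs are forgotten
  SquareSplitting : (m : ℕ) .{{_ : NonZero m}} → ℕ → Set
  SquareSplitting m x = Σ ℕ λ c → Σ (List ℕ) λ ns →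
    1 < length ns × All (λ n → 2 ≤ n × sqRes m n ≡ c) ns × prodℕ ns ≡ x

  ≢0∧≢1⇒2≤ : ∀ {n} → n ≢ 0 → n ≢ 1 → 2 ≤ n
  ≢0∧≢1⇒2≤ {0}           n≢0 _   = ⊥-elim (n≢0 refl)
  ≢0∧≢1⇒2≤ {1}           _   n≢1 = ⊥-elim (n≢1 refl)
  ≢0∧≢1⇒2≤ {suc (suc _)} _   _   = s≤s (s≤s z≤n)

  nonzeroNonunit⇔2≤∣∣ : ∀ z → NonzeroNonunit z ⇔ (2 ≤ ∣ z ∣)
  nonzeroNonunit⇔2≤∣∣ z = mk⇔
    (λ (z≢0 , ∣z∣≢1) → ≢0∧≢1⇒2≤ (λ ∣z∣≡0 → z≢0 (∣i∣≡0⇒i≡0 ∣z∣≡0)) ∣z∣≢1)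
    (λ 2≤∣z∣ → (λ z≡0 → 2≰0 (subst (λ w → 2 ≤ ∣ w ∣) z≡0 2≤∣z∣))
             , (λ ∣z∣≡1 → 2≰1 (subst (2 ≤_) ∣z∣≡1 2≤∣z∣)))
    where
    2≰0 : ¬ (2 ≤ 0)
    2≰0 ()
    2≰1 : ¬ (2 ≤ 1)
    2≰1 (s≤s ())

  ∣prodℤ∣ : ∀ zs → ∣ prodℤ zs ∣ ≡ prodℕ (map ∣_∣ zs)
  ∣prodℤ∣ []       = refl
  ∣prodℤ∣ (z ∷ zs) = trans (abs-* z (prodℤ zs)) (cong (∣ z ∣ ℕ.*_) (∣prodℤ∣ zs))

  ∣unit∣≡1 : ∀ {u} → (u ≡ + 1) ⊎ (u ≡ - (+ 1)) → ∣ u ∣ ≡ 1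
  ∣unit∣≡1 (inj₁ refl) = refl
  ∣unit∣≡1 (inj₂ refl) = refl

  τFactorisation⇒splitting : ∀ {m x} .{{_ : NonZero m}} (f : τFactorization m (+ x)) → Proper f →
                             SquareSplitting m x
  τFactorisation⇒splitting record { factors = [] } ()
  τFactorisation⇒splitting {m} {x} record { unit = u ; unit-pm1 = u≡±1 ; factors = zs@(z₁ ∷ _)
                                          ; nzNonunit = nz ; congr = congr ; eqn = eqn } proper =
    sqRes m ∣ z₁ ∣ , map ∣_∣ zs , subst (1 <_) (sym (length-map ∣_∣ zs)) proper
    , map⁺ (All.tabulate λ {z} z∈zs → Equivalence.to (nonzeroNonunit⇔2≤∣∣ z) (All.lookup nz z∈zs)
                                 , τ⇒sqRes≡ z z₁ (congr z∈zs (here refl)))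
    , sym x≡∏∣zs∣
    where
    x≡∏∣zs∣ : x ≡ prodℕ (map ∣_∣ zs)
    x≡∏∣zs∣ = begin
      x                        ≡⟨ cong ∣_∣ eqn ⟩
      ∣ u * prodℤ zs ∣         ≡⟨ abs-* u (prodℤ zs) ⟩
      ∣ u ∣ ℕ.* ∣ prodℤ zs ∣   ≡⟨ cong (ℕ._* ∣ prodℤ zs ∣) (∣unit∣≡1 u≡±1) ⟩
      1 ℕ.* ∣ prodℤ zs ∣       ≡⟨ *-identityˡ ∣ prodℤ zs ∣ ⟩
      ∣ prodℤ zs ∣             ≡⟨ ∣prodℤ∣ zs ⟩
      prodℕ (map ∣_∣ zs)       ∎

  sign-unit : ∀ S → (S ◃ 1 ≡ + 1) ⊎ (S ◃ 1 ≡ - (+ 1))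
  sign-unit Sign.+ = inj₁ refl
  sign-unit Sign.- = inj₂ refl

  liftSigns : ∀ {p} .{{_ : NonZero p}} → Prime p → (t : ℕ) (ns : List ℕ) →
              All (λ n → 2 ≤ n × sqRes p n ≡ sqRes p t) ns →
              Σ Sign λ S → Σ (List ℤ) λ zs → prodℤ zs ≡ S ◃ prodℕ ns × length zs ≡ length ns ×
                All (λ z → NonzeroNonunit z × z τ[ p ] (+ t)) zs
  liftSigns p-prime t [] [] = Sign.+ , [] , refl , refl , []
  liftSigns p-prime t (n ∷ ns) ((2≤n , same) ∷ hs)
    with sqRes≡⇒τ± n t p-prime same | liftSigns p-prime t ns hs
  ... | s , s◃n≡t | S , zs , prod≡ , length≡ , good =
    s Sign.* S , (s ◃ n) ∷ zs
    , trans (cong ((s ◃ n) *_) prod≡) (sym (◃-distrib-* s S n (prodℕ ns)))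
    , cong suc length≡
    , (Equivalence.from (nonzeroNonunit⇔2≤∣∣ (s ◃ n)) (subst (2 ≤_) (sym (abs-◃ s n)) 2≤n) , s◃n≡t)
      ∷ good

  -- modulo a prime p, signing the factors of a square splitting of x gives a proper
  -- τ_p-factorisation of x; the unit S ◃ 1 compensates the signs, as S * S = +
  splitting⇒τFactorisation : ∀ {p x} .{{_ : NonZero p}} → Prime p → SquareSplitting p x →
                             Σ (τFactorization p (+ x)) Proper
  splitting⇒τFactorisation p-prime (_ , [] , () , _)
  splitting⇒τFactorisation {p} {x} p-prime (_ , ns@(n₁ ∷ _) , proper , hs , ∏ns≡x)
    with liftSigns p-prime n₁ ns (All.map (λ (2≤n , n~c) → 2≤n , trans n~c (sym (proj₂ (All.head hs)))) hs)
  ... | S , zs , ∏zs≡ , length≡ , good = factorisation , subst (1 <_) (sym length≡) proper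
    where
    x≡ : + x ≡ (S ◃ 1) * prodℤ zs
    x≡ = begin
      + x                           ≡⟨ cong +_ (sym ∏ns≡x) ⟩
      + prodℕ ns                    ≡⟨ +◃n≡+n (prodℕ ns) ⟨
      Sign.+ ◃ prodℕ ns             ≡⟨ cong₂ _◃_ (s*s≡+ S) (*-identityˡ (prodℕ ns)) ⟨
      (S Sign.* S) ◃ (1 ℕ.* prodℕ ns) ≡⟨ ◃-distrib-* S S 1 (prodℕ ns) ⟩
      (S ◃ 1) * (S ◃ prodℕ ns)      ≡⟨ cong ((S ◃ 1) *_) ∏zs≡ ⟨
      (S ◃ 1) * prodℤ zs            ∎
    factorisation : τFactorization p (+ x)
    factorisation = record
      { unit      = S ◃ 1
      ; unit-pm1  = sign-unit S
      ; factors   = zs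
      ; nzNonunit = All.map proj₁ good
      ; congr     = λ {a} {b} a∈zs b∈zs →
          τ-trans a (+ n₁) b (proj₂ (All.lookup good a∈zs)) (τ-sym b (+ n₁) (proj₂ (All.lookup good b∈zs)))
      ; eqn       = x≡
      }

  τAtom⇔¬splitting : ∀ {p x} .{{_ : NonZero p}} → Prime p → 1 < x → τAtom p (+ x) ⇔ (¬ SquareSplitting p x)
  τAtom⇔¬splitting {x = x} p-prime 1<x = mk⇔
    (λ (_ , noProper) splitting → noProper (splitting⇒τFactorisation p-prime splitting))
    (λ noSplitting → Equivalence.from (nonzeroNonunit⇔2≤∣∣ (+ x)) 1<x
                   , λ (f , proper) → noSplitting (τFactorisation⇒splitting f proper))

module SquareResidues where

  open import Data.Nat using (ℕ; zero; suc; _*_; _≤_; z≤n; s≤s; NonZero; ≢-nonZero⁻¹)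
  open import Data.Nat.DivMod using (_%_; %-distribˡ-*; m%n<n)
  open import Data.Nat.Divisibility using (_∣_; m%n≡0⇒n∣m; n∣m⇒m%n≡0; 0∣⇒≡0; ∣-trans)
  open import Data.Nat.Primality using (Prime; productOfPrimes≢0)
  open import Data.Nat.Primality.Factorisation using (factorise; factorisationHasAllPrimeFactors; PrimeFactorisation)
  open PrimeFactorisation using (factors; isFactorisation; factorsPrime)
  open import Data.Nat.ListAction.Properties using (∈⇒∣product)
  open import Data.Nat.Tactic.RingSolver using (solve-∀)
  open import Data.List using ([]; _∷_)
  open import Data.List.Membership.Propositional using (_∈_)
  open import Data.List.Relation.Unary.All as All using (All; []; _∷_)
  open import Data.Product using (_×_; proj₁; proj₂)
  open import Data.Sum using (inj₁; inj₂)
  open import Relation.Nullary using (contradiction)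
  open import Relation.Binary.PropositionalEquality
  open ≡-Reasoning
  open Congruence using (sqRes)

  sqRes-cong : ∀ {m} n {r} .{{_ : NonZero m}} → n % m ≡ r → sqRes m n ≡ sqRes m r
  sqRes-cong {m} n n%m≡r = trans (%-distribˡ-* n n m) (cong (λ r → (r * r) % m) n%m≡r)

  sqRes-* : ∀ m a b .{{_ : NonZero m}} → sqRes m (a * b) ≡ (sqRes m a * sqRes m b) % m
  sqRes-* m a b = trans (cong (_% m) (rearrange a b)) (%-distribˡ-* (a * a) (b * b) m)
    where
    rearrange : ∀ a b → a * b * (a * b) ≡ a * a * (b * b)
    rearrange = solve-∀

  data SquareClass (n : ℕ) : Set where
    zero-class : 5 ∣ n → sqRes 5 n ≡ 0 → SquareClass n
    unit-class : ≡±1mod5 n → sqRes 5 n ≡ 1 → SquareClass n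
    two-class  : ≡±2mod5 n → sqRes 5 n ≡ 4 → SquareClass n

  ±1⇒sqRes≡1 : ∀ n → ≡±1mod5 n → sqRes 5 n ≡ 1
  ±1⇒sqRes≡1 n (inj₁ n≡1) = sqRes-cong n n≡1
  ±1⇒sqRes≡1 n (inj₂ n≡4) = sqRes-cong n n≡4

  ±2⇒sqRes≡4 : ∀ n → ≡±2mod5 n → sqRes 5 n ≡ 4
  ±2⇒sqRes≡4 n (inj₁ n≡2) = sqRes-cong n n≡2
  ±2⇒sqRes≡4 n (inj₂ n≡3) = sqRes-cong n n≡3

  5∣⇒sqRes≡0 : ∀ n → 5 ∣ n → sqRes 5 n ≡ 0
  5∣⇒sqRes≡0 n 5∣n = sqRes-cong n (n∣m⇒m%n≡0 n 5 5∣n)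

  squareClass : ∀ n → SquareClass n
  squareClass n with n % 5 in n%5 | m%n<n n 5
  ... | 0 | _ = zero-class (m%n≡0⇒n∣m n 5 n%5) (sqRes-cong n n%5)
  ... | 1 | _ = unit-class (inj₁ n%5) (±1⇒sqRes≡1 n (inj₁ n%5))
  ... | 2 | _ = two-class (inj₁ n%5) (±2⇒sqRes≡4 n (inj₁ n%5))
  ... | 3 | _ = two-class (inj₂ n%5) (±2⇒sqRes≡4 n (inj₂ n%5))
  ... | 4 | _ = unit-class (inj₂ n%5) (±1⇒sqRes≡1 n (inj₂ n%5))
  ... | suc (suc (suc (suc (suc _)))) | s≤s (s≤s (s≤s (s≤s (s≤s ()))))

  sqRes≡0⇒5∣ : ∀ n → sqRes 5 n ≡ 0 → 5 ∣ n
  sqRes≡0⇒5∣ n n~0 with squareClass n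
  ... | zero-class 5∣n _ = 5∣n
  ... | unit-class _ n~1 = contradiction (trans (sym n~0) n~1) λ ()
  ... | two-class  _ n~4 = contradiction (trans (sym n~0) n~4) λ ()

  sqRes≡4⇒2≤ : ∀ n → sqRes 5 n ≡ 4 → 2 ≤ n
  sqRes≡4⇒2≤ 0             ()
  sqRes≡4⇒2≤ 1             ()
  sqRes≡4⇒2≤ (suc (suc _)) _ = s≤s (s≤s z≤n)

  sqRes-prod≡1 : ∀ ns → All (λ n → sqRes 5 n ≡ 1) ns → sqRes 5 (prodℕ ns) ≡ 1
  sqRes-prod≡1 []       []         = refl
  sqRes-prod≡1 (n ∷ ns) (n~1 ∷ hs) = begin
    sqRes 5 (n * prodℕ ns)                  ≡⟨ sqRes-* 5 n (prodℕ ns) ⟩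
    (sqRes 5 n * sqRes 5 (prodℕ ns)) % 5    ≡⟨ cong₂ (λ a b → (a * b) % 5) n~1 (sqRes-prod≡1 ns hs) ⟩
    1                                       ∎

  -- every divisor of a product of primes ≡ ±1 (mod 5) has square residue 1,
  -- because its own prime factors are among those primes
  divisor-of-±1-product : ∀ ps d → All (λ p → Prime p × ≡±1mod5 p) ps → d ∣ prodℕ ps → sqRes 5 d ≡ 1
  divisor-of-±1-product ps zero hps 0∣P =
    contradiction (0∣⇒≡0 0∣P) (≢-nonZero⁻¹ (prodℕ ps) {{productOfPrimes≢0 (All.map proj₁ hps)}})
  divisor-of-±1-product ps d@(suc _) hps d∣P = begin
    sqRes 5 d                     ≡⟨ cong (sqRes 5) (isFactorisation F) ⟩
    sqRes 5 (prodℕ (factors F))   ≡⟨ sqRes-prod≡1 (factors F) (All.tabulate factor~1) ⟩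
    1                             ∎
    where
    F = factorise d
    factor~1 : ∀ {r} → r ∈ factors F → sqRes 5 r ≡ 1
    factor~1 {r} r∈F = ±1⇒sqRes≡1 r (proj₂ (All.lookup hps r∈ps))
      where
      r∣d : r ∣ d
      r∣d = subst (r ∣_) (sym (isFactorisation F)) (∈⇒∣product r∈F)
      r∈ps : r ∈ ps
      r∈ps = factorisationHasAllPrimeFactors (All.lookup (factorsPrime F) r∈F) (∣-trans r∣d d∣P) (All.map proj₁ hps)


module Classification where

  open import Data.Nat using (ℕ; _*_; _≤_; _<_; z≤n; s≤s; NonZero; nonTrivial⇒n>1; ≢-nonZero)
  open import Data.Nat.Properties using (*-comm; *-identityʳ; *-cancelˡ-≡; m*n≡1⇒m≡1; m≤m*n; ≤-trans)
  open import Data.Nat.DivMod using (_%_)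
  open import Data.Nat.Divisibility
    using (_∣_; divides; _∣?_; ∣-refl; ∣-trans; m∣m*n; n∣m*n; ∣m⇒∣m*n; ∣n⇒∣m*n; *-pres-∣; *-monoʳ-∣; *-cancelˡ-∣; ∣1⇒≡1; ∣⇒≤; module ∣-Reasoning)
  open import Data.Nat.Primality using (Prime; prime?; prime⇒nonZero; prime⇒nonTrivial; prime⇒irreducible; euclidsLemma)
  open import Data.Nat.Primality.Factorisation using (factorise; factorisationHasAllPrimeFactors; PrimeFactorisation)
  open PrimeFactorisation using (factors; isFactorisation; factorsPrime)
  open import Data.Nat.ListAction.Properties using (∈⇒∣product)
  open import Data.Nat.Tactic.RingSolver using (solve-∀)
  open import Data.List using (List; []; _∷_)
  open import Data.List.Membership.Propositional using (_∈_)
  open import Data.List.Relation.Unary.All as All using (All; []; _∷_)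
  open import Data.List.Relation.Unary.Any using (Any; here; there)
  open import Data.Product using (_×_; _,_; proj₁; proj₂)
  open import Data.Sum using (_⊎_; inj₁; inj₂; [_,_]′)
  open import Function.Base using (id; _∘_)
  open import Function.Bundles using (_⇔_; mk⇔)
  open import Relation.Nullary using (¬_; contradiction; yes; no)
  open import Relation.Nullary.Decidable using (from-yes)
  open import Relation.Binary.PropositionalEquality
  open Congruence using (sqRes)
  open Bridge using (SquareSplitting)
  open SquareResidues

  5-prime : Prime 5
  5-prime = from-yes (prime? 5)

  prime⇒2≤ : ∀ {p} → Prime p → 2 ≤ p
  prime⇒2≤ {p} p-prime = nonTrivial⇒n>1 p {{prime⇒nonTrivial p-prime}}

  prime∣prod⇒Any : ∀ {p} ns → Prime p → p ∣ prodℕ ns → Any (p ∣_) ns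
  prime∣prod⇒Any [] p-prime p∣1 = contradiction (subst (2 ≤_) (∣1⇒≡1 p∣1) (prime⇒2≤ p-prime)) λ { (s≤s ()) }
  prime∣prod⇒Any (n ∷ ns) p-prime p∣n*∏ns with euclidsLemma n (prodℕ ns) p-prime p∣n*∏ns
  ... | inj₁ p∣n  = here p∣n
  ... | inj₂ p∣∏ns = there (prime∣prod⇒Any ns p-prime p∣∏ns)

  -- if qP = ab with q prime, then q is absorbed by one side and the other side divides P
  prime-cofactor : ∀ {q P a b} → Prime q → q * P ≡ a * b → a ∣ P ⊎ b ∣ P
  prime-cofactor {q} {P} {a} {b} q-prime qP≡ab =
    absorb (euclidsLemma a b q-prime (divides P (trans (sym qP≡ab) (*-comm q P))))
    where
    instance _ = prime⇒nonZero q-prime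
    cancel-q : ∀ R → a * b ≡ q * R → P ≡ R
    cancel-q R ab≡qR = *-cancelˡ-≡ P R q (trans qP≡ab ab≡qR)
    regroupˡ : ∀ k q b → k * q * b ≡ q * (k * b)
    regroupˡ = solve-∀
    regroupʳ : ∀ a k q → a * (k * q) ≡ q * (a * k)
    regroupʳ = solve-∀
    absorb : q ∣ a ⊎ q ∣ b → a ∣ P ⊎ b ∣ P
    absorb (inj₁ (divides k a≡kq)) =
      inj₂ (subst (b ∣_) (sym (cancel-q (k * b) (trans (cong (_* b) a≡kq) (regroupˡ k q b)))) (n∣m*n k))
    absorb (inj₂ (divides k b≡kq)) =
      inj₁ (subst (a ∣_) (sym (cancel-q (a * k) (trans (cong (a *_) b≡kq) (regroupʳ a k q)))) (m∣m*n k))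

  -- a prime has no splitting: its factor n₁ ≥ 2 would have to be the prime itself,
  -- leaving a cofactor n₂ ⋯ equal to 1
  prime⇒¬splitting : ∀ {m x} .{{_ : NonZero m}} → Prime x → ¬ SquareSplitting m x
  prime⇒¬splitting _ (_ , _ ∷ [] , s≤s () , _)
  prime⇒¬splitting {x = x} x-prime (_ , n₁ ∷ n₂ ∷ rest , _ , (2≤n₁ , _) ∷ (2≤n₂ , _) ∷ _ , ∏≡x)
    with prime⇒irreducible x-prime (divides (n₂ * prodℕ rest) (trans (sym ∏≡x) (*-comm n₁ _)))
  ... | inj₁ n₁≡1 = contradiction (subst (2 ≤_) n₁≡1 2≤n₁) λ { (s≤s ()) }
  ... | inj₂ n₁≡x = contradiction (subst (2 ≤_) n₂≡1 2≤n₂) λ { (s≤s ()) }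
    where
    open ≡-Reasoning
    instance _ = prime⇒nonZero x-prime
    n₂≡1 : n₂ ≡ 1
    n₂≡1 = m*n≡1⇒m≡1 n₂ (prodℕ rest) (*-cancelˡ-≡ _ 1 x (begin
      x * (n₂ * prodℕ rest)   ≡⟨ cong (_* (n₂ * prodℕ rest)) n₁≡x ⟨
      n₁ * (n₂ * prodℕ rest)  ≡⟨ ∏≡x ⟩
      x                       ≡⟨ *-identityʳ x ⟨
      x * 1                   ∎))

  -- form (ii) has no splitting: 5 divides some factor, so the common square residue is 0,
  -- so 25 divides n₁n₂ and hence x = 5P, forcing 5 ∣ P, which a product of primes ≠ 5 is not
  formII⇒¬splitting : ∀ {x} → FormII x → ¬ SquareSplitting 5 x
  formII⇒¬splitting _ (_ , _ ∷ [] , s≤s () , _)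
  formII⇒¬splitting (ps , hps , x≡5P)
                    (c , ns@(n₁ ∷ n₂ ∷ rest) , _ , hs@((_ , n₁~c) ∷ (_ , n₂~c) ∷ _) , ∏≡x) = 5∤P 5∣P
    where
    P = prodℕ ps
    5∤P : ¬ 5 ∣ P
    5∤P 5∣P = proj₂ (All.lookup hps (factorisationHasAllPrimeFactors 5-prime 5∣P (All.map proj₁ hps))) refl
    c≡0 : c ≡ 0
    c≡0 with All.lookupAny hs (prime∣prod⇒Any ns 5-prime (divides P (trans ∏≡x (trans x≡5P (*-comm 5 P)))))
    ... | (_ , n~c) , 5∣n = trans (sym n~c) (5∣⇒sqRes≡0 _ 5∣n)
    5∣P : 5 ∣ P
    5∣P = *-cancelˡ-∣ 5 (begin
      5 * 5                    ∣⟨ *-pres-∣ (sqRes≡0⇒5∣ n₁ (trans n₁~c c≡0)) (sqRes≡0⇒5∣ n₂ (trans n₂~c c≡0)) ⟩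
      n₁ * n₂                  ∣⟨ *-monoʳ-∣ n₁ (m∣m*n (prodℕ rest)) ⟩
      n₁ * (n₂ * prodℕ rest)   ≡⟨ trans ∏≡x x≡5P ⟩
      5 * P                    ∎)
      where open ∣-Reasoning

  -- form (iii) has no splitting: the prime q ≡ ±2 lies in one factor, so another factor
  -- divides P and has square residue 1; then x has square residue 1, but qP has residue 4
  formIII⇒¬splitting : ∀ {x} → FormIII x → ¬ SquareSplitting 5 x
  formIII⇒¬splitting _ (_ , _ ∷ [] , s≤s () , _)
  formIII⇒¬splitting {x} (q , ps , q-prime , q±2 , hps , x≡qP)
                         (c , ns@(n₁ ∷ n₂ ∷ rest) , _ , hs@((_ , n₁~c) ∷ (_ , n₂~c) ∷ _) , ∏≡x) =
    contradiction (trans (sym x~1) x~4) λ ()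
    where
    open ≡-Reasoning
    P = prodℕ ps
    c≡1 : c ≡ 1
    c≡1 = [ (λ n₁∣P → trans (sym n₁~c) (divisor-of-±1-product ps n₁ hps n₁∣P))
          , (λ n₂R∣P → trans (sym n₂~c) (divisor-of-±1-product ps n₂ hps (∣-trans (m∣m*n (prodℕ rest)) n₂R∣P)))
          ]′ (prime-cofactor q-prime (trans (sym x≡qP) (sym ∏≡x)))
    x~1 : sqRes 5 x ≡ 1
    x~1 = subst (λ y → sqRes 5 y ≡ 1) ∏≡x (sqRes-prod≡1 ns (All.map (λ (_ , n~c) → trans n~c c≡1) hs))
    x~4 : sqRes 5 x ≡ 4
    x~4 = begin
      sqRes 5 x                            ≡⟨ cong (sqRes 5) x≡qP ⟩
      sqRes 5 (q * P)                      ≡⟨ sqRes-* 5 q P ⟩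
      (sqRes 5 q * sqRes 5 P) % 5          ≡⟨ cong₂ (λ a b → (a * b) % 5) (±2⇒sqRes≡4 q q±2)
                                                    (divisor-of-±1-product ps P hps ∣-refl) ⟩
      4                                    ∎

  HasForm : ℕ → Set
  HasForm x = Prime x ⊎ FormII x ⊎ FormIII x

  form⇒¬splitting : ∀ {x} → HasForm x → ¬ SquareSplitting 5 x
  form⇒¬splitting (inj₁ x-prime)        = prime⇒¬splitting x-prime
  form⇒¬splitting (inj₂ (inj₁ formII))  = formII⇒¬splitting formII
  form⇒¬splitting (inj₂ (inj₂ formIII)) = formIII⇒¬splitting formIII

  split₂ : ∀ {m a b} .{{_ : NonZero m}} → 2 ≤ a → 2 ≤ b → sqRes m a ≡ sqRes m b → SquareSplitting m (a * b)
  split₂ {m} {a} {b} 2≤a 2≤b a~b =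
    sqRes m b , a ∷ b ∷ [] , s≤s (s≤s z≤n) , (2≤a , a~b) ∷ (2≤b , refl) ∷ [] , cong (a *_) (*-identityʳ b)

  split₃ : ∀ {m a b c} .{{_ : NonZero m}} → 2 ≤ a → 2 ≤ b → 2 ≤ c →
           sqRes m a ≡ sqRes m c → sqRes m b ≡ sqRes m c → SquareSplitting m (a * (b * c))
  split₃ {m} {a} {b} {c} 2≤a 2≤b 2≤c a~c b~c =
    sqRes m c , a ∷ b ∷ c ∷ [] , s≤s (s≤s z≤n) , (2≤a , a~c) ∷ (2≤b , b~c) ∷ (2≤c , refl) ∷ []
    , cong (λ d → a * (b * d)) (*-identityʳ c)

  -- x = 5m: if also 5 ∣ m, then 5 · m splits with residue 0; otherwise x has form (ii),
  -- the prime factors of m being different from 5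
  five-case : ∀ {x} m .{{_ : NonZero m}} → x ≡ m * 5 → HasForm x ⊎ SquareSplitting 5 x
  five-case {x} m x≡m5 with 5 ∣? m
  ... | yes 5∣m = inj₂ (subst (SquareSplitting 5) (sym (trans x≡m5 (*-comm m 5)))
                    (split₂ {a = 5} {b = m} 2≤5 (≤-trans 2≤5 (∣⇒≤ 5∣m)) (sym (5∣⇒sqRes≡0 m 5∣m))))
    where
    2≤5 : 2 ≤ 5
    2≤5 = s≤s (s≤s z≤n)
  ... | no 5∤m  = inj₁ (inj₂ (inj₁ (factors F , All.tabulate prime≢5 , x≡5∏F)))
    where
    F = factorise m
    prime≢5 : ∀ {p} → p ∈ factors F → Prime p × p ≢ 5
    prime≢5 {p} p∈F = All.lookup (factorsPrime F) p∈F
                    , λ p≡5 → 5∤m (subst (_∣ m) p≡5 (subst (p ∣_) (sym (isFactorisation F)) (∈⇒∣product p∈F)))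
    x≡5∏F : x ≡ 5 * prodℕ (factors F)
    x≡5∏F = trans x≡m5 (trans (*-comm m 5) (cong (5 *_) (isFactorisation F)))

  -- t₁ · t₂ · r with t₁, t₂ of residue 4 and 5 ∤ r splits: as t₁ · t₂r when r has residue 1,
  -- and as t₁ · t₂ · r when r has residue 4
  two-twos-split : ∀ {t₁ t₂ r} → 2 ≤ t₁ → 2 ≤ t₂ → sqRes 5 t₁ ≡ 4 → sqRes 5 t₂ ≡ 4 → ¬ 5 ∣ r →
                   SquareSplitting 5 (t₁ * (t₂ * r))
  two-twos-split {t₂ = t₂} {r = r} 2≤t₁ 2≤t₂ t₁~4 t₂~4 5∤r with squareClass r
  ... | zero-class 5∣r _ = contradiction 5∣r 5∤r
  ... | two-class _ r~4  = split₃ 2≤t₁ 2≤t₂ (sqRes≡4⇒2≤ r r~4) (trans t₁~4 (sym r~4)) (trans t₂~4 (sym r~4))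
  ... | unit-class _ r~1 = split₂ 2≤t₁ 2≤t₂r (trans t₁~4 (sym t₂r~4))
    where
    r≢0 : r ≢ 0
    r≢0 r≡0 = contradiction (subst (λ n → sqRes 5 n ≡ 1) r≡0 r~1) λ ()
    2≤t₂r : 2 ≤ t₂ * r
    2≤t₂r = ≤-trans 2≤t₂ (m≤m*n t₂ r {{≢-nonZero r≢0}})
    t₂r~4 : sqRes 5 (t₂ * r) ≡ 4
    t₂r~4 = trans (sqRes-* 5 t₂ r) (cong₂ (λ a b → (a * b) % 5) t₂~4 r~1)

  data Shape (fs : List ℕ) : Set where
    no-two   : All (λ p → Prime p × ≡±1mod5 p) fs → Shape fs
    one-two  : ∀ q ps → Prime q → ≡±2mod5 q → All (λ p → Prime p × ≡±1mod5 p) ps →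
               prodℕ fs ≡ q * prodℕ ps → Shape fs
    two-twos : ∀ t₁ t₂ r → 2 ≤ t₁ → 2 ≤ t₂ → sqRes 5 t₁ ≡ 4 → sqRes 5 t₂ ≡ 4 →
               prodℕ fs ≡ t₁ * (t₂ * r) → Shape fs

  shape : ∀ fs → All Prime fs → ¬ 5 ∣ prodℕ fs → Shape fs
  shape []       []                 _   = no-two []
  shape (p ∷ fs) (p-prime ∷ primes) 5∤∏ with squareClass p | shape fs primes (5∤∏ ∘ ∣n⇒∣m*n p)
  ... | zero-class 5∣p _ | _ = contradiction (∣m⇒∣m*n (prodℕ fs) 5∣p) 5∤∏
  ... | unit-class p±1 _ | no-two ps±1 = no-two ((p-prime , p±1) ∷ ps±1)
  ... | two-class p±2 _  | no-two ps±1 = one-two p fs p-prime p±2 ps±1 refl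
  ... | unit-class p±1 _ | one-two q ps q-prime q±2 ps±1 ∏≡qP =
    one-two q (p ∷ ps) q-prime q±2 ((p-prime , p±1) ∷ ps±1) (trans (cong (p *_) ∏≡qP) (swap p q (prodℕ ps)))
    where
    swap : ∀ p q P → p * (q * P) ≡ q * (p * P)
    swap = solve-∀
  ... | two-class _ p~4  | one-two q ps q-prime q±2 _ ∏≡qP =
    two-twos p q (prodℕ ps) (prime⇒2≤ p-prime) (prime⇒2≤ q-prime) p~4 (±2⇒sqRes≡4 q q±2) (cong (p *_) ∏≡qP)
  ... | _ | two-twos t₁ t₂ r 2≤t₁ 2≤t₂ t₁~4 t₂~4 ∏≡t₁t₂r =
    two-twos t₁ t₂ (p * r) 2≤t₁ 2≤t₂ t₁~4 t₂~4 (trans (cong (p *_) ∏≡t₁t₂r) (shift p t₁ t₂ r))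
    where
    shift : ∀ p a b r → p * (a * (b * r)) ≡ a * (b * (p * r))
    shift = solve-∀

  coprime-case : ∀ x → 1 < x → ¬ 5 ∣ x → HasForm x ⊎ SquareSplitting 5 x
  coprime-case x 1<x 5∤x = from-shape (factors F) (factorsPrime F) (isFactorisation F)
    (shape (factors F) (factorsPrime F) (5∤x ∘ subst (5 ∣_) (sym (isFactorisation F))))
    where
    instance _ = ≢-nonZero (λ x≡0 → contradiction (subst (1 <_) x≡0 1<x) λ ())
    F = factorise x
    from-shape : ∀ fs → All Prime fs → x ≡ prodℕ fs → Shape fs → HasForm x ⊎ SquareSplitting 5 x
    from-shape [] _ x≡1 _ = contradiction (subst (1 <_) x≡1 1<x) λ { (s≤s ()) }
    from-shape (p ∷ []) (p-prime ∷ []) x≡p _ = inj₁ (inj₁ (subst Prime (sym (trans x≡p (*-identityʳ p))) p-prime))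
    from-shape fs@(_ ∷ _ ∷ _) _ x≡∏ (no-two fs±1) =
      inj₂ (1 , fs , s≤s (s≤s z≤n) , All.map (λ {p} (p-prime , p±1) → prime⇒2≤ p-prime , ±1⇒sqRes≡1 p p±1) fs±1 , sym x≡∏)
    from-shape fs _ x≡∏ (one-two q ps q-prime q±2 ps±1 ∏≡qP) =
      inj₁ (inj₂ (inj₂ (q , ps , q-prime , q±2 , ps±1 , trans x≡∏ ∏≡qP)))
    from-shape fs _ x≡∏ (two-twos t₁ t₂ r 2≤t₁ 2≤t₂ t₁~4 t₂~4 ∏≡t₁t₂r) =
      inj₂ (subst (SquareSplitting 5) (sym x≡t₁t₂r) (two-twos-split 2≤t₁ 2≤t₂ t₁~4 t₂~4 5∤r))
      where
      x≡t₁t₂r : x ≡ t₁ * (t₂ * r)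
      x≡t₁t₂r = trans x≡∏ ∏≡t₁t₂r
      5∤r : ¬ 5 ∣ r
      5∤r 5∣r = 5∤x (subst (5 ∣_) (sym x≡t₁t₂r) (∣n⇒∣m*n t₁ (∣n⇒∣m*n t₂ 5∣r)))

  form-or-splitting : ∀ x → 1 < x → HasForm x ⊎ SquareSplitting 5 x
  form-or-splitting x 1<x with 5 ∣? x
  ... | no 5∤x                = coprime-case x 1<x 5∤x
  ... | yes (divides m x≡m5) = five-case m {{≢-nonZero m≢0}} x≡m5
    where
    m≢0 : m ≢ 0
    m≢0 m≡0 = contradiction (subst (1 <_) (trans x≡m5 (cong (_* 5) m≡0)) 1<x) λ ()

  ¬splitting⇔form : ∀ {x} → 1 < x → (¬ SquareSplitting 5 x) ⇔ HasForm x
  ¬splitting⇔form {x} 1<x = mk⇔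
    (λ noSplitting → [ id , (λ split → contradiction split noSplitting) ]′ (form-or-splitting x 1<x))
    form⇒¬splitting

open Bridge using (τAtom⇔¬splitting)
open Classification using (5-prime; ¬splitting⇔form)

theorem9 : (x : ℕ) → 1 < x →
    τAtom 5 (+ x) ⇔ (Prime x ⊎ FormII x ⊎ FormIII x)
theorem9 x 1<x = ⇔-trans (τAtom⇔¬splitting 5-prime 1<x) (¬splitting⇔form 1<x)
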